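{- If $\mathbf{x}$ is an infinite binary word that is $2$-pseudoperiodic, then $\mathbf{x}$ contains a $(7/3)$-power, i.e., $\mathbf{x}$ has a nonempty finite factor $y$ with $\exp(y)\ge 7/3$.
   Context: For integers $0<p_1<p_2$, an infinite word $\mathbf{x}$ (indexed from $0$) has pseudoperiod $(p_1,p_2)$ if $\mathbf{x}[i]\in\{\mathbf{x}[i+p_1],\mathbf{x}[i+p_2]\}$ for all $i\ge0$; it is $2$-pseudoperiodic if it has some such pseudoperiod. The exponent of a nonempty finite word $y$ is $\exp(y)=|y|/p$ where $p$ is the smallest period of $y$ (the least $p\ge1$ with $y[i]=y[i+p]$ for all $0\le i<|y|-p$). -}

module Defs where

open import Data.Nat using (ℕ; _+_; _*_; _<_; _≤_)
open import Data.Bool using (Bool)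
open import Data.Product using (Σ; ∃; _×_)
open import Data.Sum using (_⊎_)
open import Relation.Binary.PropositionalEquality using (_≡_)
open import Relation.Nullary using (¬_)

Word : Set
Word = ℕ → Bool

HasPseudoperiod : Word → ℕ → ℕ → Set
HasPseudoperiod x p₁ p₂ =
  (0 < p₁) × (p₁ < p₂) × (∀ i → (x i ≡ x (i + p₁)) ⊎ (x i ≡ x (i + p₂)))

TwoPseudoperiodic : Word → Set
TwoPseudoperiodic x = ∃ λ p₁ → ∃ λ p₂ → HasPseudoperiod x p₁ p₂

-- The factor of x starting at position i with length n is y = x[i..i+n-1].
-- p is a period of that factor: y[j] = y[j+p] for all 0 ≤ j < n - p.
IsPeriodOfFactor : Word → ℕ → ℕ → ℕ → Set
IsPeriodOfFactor x i n p = ∀ j → j + p < n → x (i + j) ≡ x (i + j + p)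

IsSmallestPeriodOfFactor : Word → ℕ → ℕ → ℕ → Set
IsSmallestPeriodOfFactor x i n p =
  (1 ≤ p) × IsPeriodOfFactor x i n p ×
  (∀ q → 1 ≤ q → q < p → ¬ IsPeriodOfFactor x i n q)

-- exp(y) = n / p ≥ 7/3, stated as 7 * p ≤ 3 * n (exact rational comparison).
ExpAtLeast7/3 : ℕ → ℕ → Set
ExpAtLeast7/3 n p = 7 * p ≤ 3 * n

Contains7/3Power : Word → Set
Contains7/3Power x =
  ∃ λ i → ∃ λ n → ∃ λ p →
    (1 ≤ n) × IsSmallestPeriodOfFactor x i n p × ExpAtLeast7/3 n p

{-# OPTIONS --safe #-}
module Submission where

-- A (7/3)-power-free binary word contains no factor aaa, ababa or abcabca. Hence, from an offset
-- k ≤ 5 on, a long power-free prefix is a concatenation of the blocks 01 and 10: it is the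
-- Thue–Morse image of a shorter word y, which is again power-free. Allowing complementation
-- (x i = s ⊕ x (i + a) or x i = t ⊕ x (i + b)), a pseudoperiod (a, b) of x induces one of y with
-- parameters about (a/2, b/2), still nondegenerate for a suitable parity of the positions read.
-- Iterating ends with a = 0 or a = b, that is with a period or an antiperiod, and either gives a
-- cube. Everything happens in a prefix of bounded length, where the existence of a (7/3)-power is
-- decidable; this turns the contradiction into a witness.

open import Defs
open import Data.Bool.Base using (Bool; true; false; not; _xor_)
open import Data.Bool.Properties using (¬-not; not-¬; not-involutive; xor-assoc; xor-comm; xor-same)
  renaming (_≟_ to _≟ᴮ_)
open import Data.Nat.Base
open import Data.Nat.Properties
open import Data.Nat.Induction using (<-rec)
open import Data.Nat.Tactic.RingSolver using (solve-∀)
open import Data.Product using (_×_; _,_; ∃; ∃₂; Σ)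
open import Data.Sum using (_⊎_; inj₁; inj₂)
open import Data.Empty using (⊥; ⊥-elim)
open import Function using (_∘_)
open import Relation.Nullary using (¬_; Dec; yes; no)
open import Relation.Nullary.Decidable using (map′; _×-dec_; _→-dec_)
open import Relation.Binary.PropositionalEquality

-- the period p need not be the least one
PowerBefore : Word → ℕ → Set
PowerBefore x ℓ = ∃ λ i → ∃ λ n → ∃ λ p →
  i + n ≤ ℓ × 1 ≤ p × IsPeriodOfFactor x i n p × ExpAtLeast7/3 n p

PowerFree : Word → ℕ → Set
PowerFree x ℓ = ¬ PowerBefore x ℓ

isPeriodOfFactor? : ∀ x i n p → Dec (IsPeriodOfFactor x i n p)
isPeriodOfFactor? x i n p = map′
  (λ per j j+p<n → per (m+n≤o⇒m≤o (suc j) j+p<n) j+p<n)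
  (λ per {j} _ → per j)
  (allUpTo? (λ j → (j + p <? n) →-dec (x (i + j) ≟ᴮ x (i + j + p))) n)

powerBefore? : ∀ x ℓ → Dec (PowerBefore x ℓ)
powerBefore? x ℓ = map′
  (λ (i , _ , n , _ , p , _ , power) → i , n , p , power)
  (λ (i , n , p , i+n≤ℓ , 1≤p , per , exp) →
    i , s≤s (m+n≤o⇒m≤o i i+n≤ℓ) , n , s≤s (m+n≤o⇒n≤o i i+n≤ℓ) ,
    p , s≤s (≤-trans (m≤n*m p 7) (≤-trans exp (*-monoʳ-≤ 3 (m+n≤o⇒n≤o i i+n≤ℓ)))) ,
    i+n≤ℓ , 1≤p , per , exp)
  (anyUpTo? (λ i → anyUpTo? (λ n → anyUpTo? (λ p →
      (i + n ≤? ℓ) ×-dec (1 ≤? p) ×-dec isPeriodOfFactor? x i n p ×-dec (7 * p ≤? 3 * n))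
    (suc (3 * ℓ))) (suc ℓ)) (suc ℓ))

smallestPeriod : ∀ x i n p → 1 ≤ p → IsPeriodOfFactor x i n p →
  ∃ λ q → q ≤ p × IsSmallestPeriodOfFactor x i n q
smallestPeriod x i n = <-rec _ search
  where
  search : ∀ p → (∀ {q} → q < p → 1 ≤ q → IsPeriodOfFactor x i n q →
                    ∃ λ r → r ≤ q × IsSmallestPeriodOfFactor x i n r) →
           1 ≤ p → IsPeriodOfFactor x i n p → ∃ λ r → r ≤ p × IsSmallestPeriodOfFactor x i n r
  search p smaller 1≤p per with anyUpTo? (λ q → (1 ≤? q) ×-dec isPeriodOfFactor? x i n q) p
  ... | yes (q , q<p , 1≤q , perq) =
    let r , r≤q , smallest = smaller q<p 1≤q perq in r , ≤-trans r≤q (<⇒≤ q<p) , smallest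
  ... | no none = p , ≤-refl , 1≤p , per , λ q 1≤q q<p perq → none (q , q<p , 1≤q , perq)

power⇒contains7/3Power : ∀ {x ℓ} → PowerBefore x ℓ → Contains7/3Power x
power⇒contains7/3Power {x} (i , n , p , _ , 1≤p , per , exp) =
  let q , q≤p , smallest = smallestPeriod x i n p 1≤p per
  in i , n , q , nonempty n 1≤p exp , smallest , ≤-trans (*-monoʳ-≤ 7 q≤p) exp
  where
  nonempty : ∀ n → 1 ≤ p → 7 * p ≤ 3 * n → 1 ≤ n
  nonempty zero (s≤s _) ()
  nonempty (suc _) _ _ = s≤s z≤n

-- indices are written j + i so that they compute for literal j, as in noAaa below
noPeriodicFactor : ∀ {ℓ} x i n p → PowerFree x ℓ → i + n ≤ ℓ → 1 ≤ p → 7 * p ≤ 3 * n →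
  ¬ (∀ j → p + j < n → x (j + i) ≡ x (j + p + i))
noPeriodicFactor x i n p free i+n≤ℓ 1≤p exp per = free (i , n , p , i+n≤ℓ , 1≤p , per′ , exp)
  where
  per′ : IsPeriodOfFactor x i n p
  per′ j j+p<n = begin
    x (i + j)     ≡⟨ cong x (+-comm i j) ⟩
    x (j + i)     ≡⟨ per j (subst (_< n) (+-comm j p) j+p<n) ⟩
    x (j + p + i) ≡⟨ cong x (reorder i j p) ⟩
    x (i + j + p) ∎
    where
    open ≡-Reasoning
    reorder : ∀ i j p → j + p + i ≡ i + j + p
    reorder = solve-∀

Aaa : Bool → Bool → Bool → Set
Aaa a b c = a ≡ b × b ≡ c

Ababa : Bool → Bool → Bool → Bool → Bool → Set
Ababa a b c d e = a ≡ c × b ≡ d × c ≡ e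

Abcabca : Bool → Bool → Bool → Bool → Bool → Bool → Bool → Set
Abcabca a b c d e f g = a ≡ d × b ≡ e × c ≡ f × d ≡ g

afterSquare : ∀ b₀ b₁ b₂ b₃ b₄ b₅ b₆ →
  ¬ Aaa b₀ b₁ b₂ → ¬ Aaa b₁ b₂ b₃ → ¬ Aaa b₄ b₅ b₆ → ¬ Ababa b₂ b₃ b₄ b₅ b₆ →
  ¬ Abcabca b₀ b₁ b₂ b₃ b₄ b₅ b₆ → b₁ ≡ b₂ →
  b₂ ≢ b₃ × (b₃ ≡ b₄ ⊎ (b₄ ≢ b₅ × b₅ ≡ b₆))
afterSquare _     false true  _     _     _     _     _ _ _ _ _ ()
afterSquare _     true  false _     _     _     _     _ _ _ _ _ ()
afterSquare false false false _     _     _     _     aaa _ _ _ _ _ = ⊥-elim (aaa (refl , refl))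
afterSquare true  false false false _     _     _     _ aaa _ _ _ _ = ⊥-elim (aaa (refl , refl))
afterSquare true  false false true  true  _     _     _ _ _ _ _ _ = (λ ()) , inj₁ refl
afterSquare true  false false true  false false false _ _ aaa _ _ _ = ⊥-elim (aaa (refl , refl))
afterSquare true  false false true  false false true  _ _ _ _ abcabca _ =
  ⊥-elim (abcabca (refl , refl , refl , refl))
afterSquare true  false false true  false true  false _ _ _ ababa _ _ =
  ⊥-elim (ababa (refl , refl , refl))
afterSquare true  false false true  false true  true  _ _ _ _ _ _ = (λ ()) , inj₂ ((λ ()) , refl)
afterSquare true  true  true  _     _     _     _     aaa _ _ _ _ _ = ⊥-elim (aaa (refl , refl))
afterSquare false true  true  true  _     _     _     _ aaa _ _ _ _ = ⊥-elim (aaa (refl , refl))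
afterSquare false true  true  false false _     _     _ _ _ _ _ _ = (λ ()) , inj₁ refl
afterSquare false true  true  false true  true  true  _ _ aaa _ _ _ = ⊥-elim (aaa (refl , refl))
afterSquare false true  true  false true  true  false _ _ _ _ abcabca _ =
  ⊥-elim (abcabca (refl , refl , refl , refl))
afterSquare false true  true  false true  false true  _ _ _ ababa _ _ =
  ⊥-elim (ababa (refl , refl , refl))
afterSquare false true  true  false true  false false _ _ _ _ _ _ = (λ ()) , inj₂ ((λ ()) , refl)

≢-≢⇒≡ : ∀ {a b c : Bool} → a ≢ b → b ≢ c → a ≡ c
≢-≢⇒≡ {c = c} a≢b b≢c = trans (¬-not a≢b) (trans (cong not (¬-not b≢c)) (not-involutive c))

alternating⇒ababa : ∀ {a b c d e} → a ≢ b → b ≢ c → c ≢ d → d ≢ e → Ababa a b c d e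
alternating⇒ababa a≢b b≢c c≢d d≢e = ≢-≢⇒≡ a≢b b≢c , ≢-≢⇒≡ b≢c c≢d , ≢-≢⇒≡ c≢d d≢e

SquareAt : Word → ℕ → Set
SquareAt x u = x u ≡ x (1 + u)

-- x [k, ℓ - 5) is the image of a word under the Thue–Morse morphism 0 ↦ 01, 1 ↦ 10
ThueMorseImageFrom : Word → ℕ → ℕ → Set
ThueMorseImageFrom x ℓ k = ∀ m → m + m + k + 5 ≤ ℓ → x (suc (m + m + k)) ≡ not (x (m + m + k))

two-blocks-later : ∀ m t → m + m + (2 + (2 + t)) ≡ suc m + suc m + (2 + t)
two-blocks-later = solve-∀

window-after-blocks : ∀ m t → 7 + t ≤ m + m + (2 + t) + 5
window-after-blocks m t = ≤-trans (m≤n+m (7 + t) (m + m)) (≤-reflexive (reassociate m t))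
  where
  reassociate : ∀ m t → m + m + (7 + t) ≡ m + m + (2 + t) + 5
  reassociate = solve-∀

module _ {x : Word} {ℓ : ℕ} (free : PowerFree x ℓ) where

  noAaa : ∀ t → 3 + t ≤ ℓ → ¬ Aaa (x t) (x (1 + t)) (x (2 + t))
  noAaa t len (e₀ , e₁) =
    noPeriodicFactor x t 3 1 free (subst (_≤ ℓ) (+-comm 3 t) len) ≤-refl (m≤m+n 7 2) per
    where
    per : ∀ j → 1 + j < 3 → x (j + t) ≡ x (j + 1 + t)
    per 0 _ = e₀
    per 1 _ = e₁
    per (suc (suc _)) (s≤s (s≤s (s≤s ())))

  noAbaba : ∀ t → 5 + t ≤ ℓ → ¬ Ababa (x t) (x (1 + t)) (x (2 + t)) (x (3 + t)) (x (4 + t))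
  noAbaba t len (e₀ , e₁ , e₂) =
    noPeriodicFactor x t 5 2 free (subst (_≤ ℓ) (+-comm 5 t) len) (s≤s z≤n) (m≤m+n 14 1) per
    where
    per : ∀ j → 2 + j < 5 → x (j + t) ≡ x (j + 2 + t)
    per 0 _ = e₀
    per 1 _ = e₁
    per 2 _ = e₂
    per (suc (suc (suc _))) (s≤s (s≤s (s≤s (s≤s (s≤s ())))))

  noAbcabca : ∀ t → 7 + t ≤ ℓ →
    ¬ Abcabca (x t) (x (1 + t)) (x (2 + t)) (x (3 + t)) (x (4 + t)) (x (5 + t)) (x (6 + t))
  noAbcabca t len (e₀ , e₁ , e₂ , e₃) =
    noPeriodicFactor x t 7 3 free (subst (_≤ ℓ) (+-comm 7 t) len) (s≤s z≤n) ≤-refl per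
    where
    per : ∀ j → 3 + j < 7 → x (j + t) ≡ x (j + 3 + t)
    per 0 _ = e₀
    per 1 _ = e₁
    per 2 _ = e₂
    per 3 _ = e₃
    per (suc (suc (suc (suc _)))) (s≤s (s≤s (s≤s (s≤s (s≤s (s≤s (s≤s ())))))))

  nextSquare : ∀ t → 7 + t ≤ ℓ → SquareAt x (1 + t) →
    x (2 + t) ≢ x (3 + t) × (SquareAt x (3 + t) ⊎ (x (4 + t) ≢ x (5 + t) × SquareAt x (5 + t)))
  nextSquare t len = afterSquare _ _ _ _ _ _ _
    (noAaa t (window 3 (m≤m+n 3 4))) (noAaa (1 + t) (window 4 (m≤m+n 4 3)))
    (noAaa (4 + t) len) (noAbaba (2 + t) len) (noAbcabca t len)
    where
    window : ∀ w → w ≤ 7 → w + t ≤ ℓ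
    window w w≤7 = ≤-trans (+-monoˡ-≤ t w≤7) len

  initialSquare : 6 ≤ ℓ → ∃ λ t → t ≤ 3 × SquareAt x (1 + t)
  initialSquare len with x 1 ≟ᴮ x 2 | x 2 ≟ᴮ x 3 | x 3 ≟ᴮ x 4 | x 4 ≟ᴮ x 5
  ... | yes square | _ | _ | _ = 0 , z≤n , square
  ... | no _ | yes square | _ | _ = 1 , s≤s z≤n , square
  ... | no _ | no _ | yes square | _ = 2 , s≤s (s≤s z≤n) , square
  ... | no _ | no _ | no _ | yes square = 3 , ≤-refl , square
  ... | no d₁ | no d₂ | no d₃ | no d₄ = ⊥-elim (noAbaba 1 len (alternating⇒ababa d₁ d₂ d₃ d₄))

  unequal-subst : ∀ {u v} → u ≡ v → x u ≢ x (suc u) → x v ≢ x (suc v)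
  unequal-subst = subst (λ u → x u ≢ x (suc u))

  -- by nextSquare the next square lies 2 or 4 positions further, so the pairs in between alternate
  alternatesAfterSquare : ∀ m t → SquareAt x (1 + t) → m + m + (2 + t) + 5 ≤ ℓ →
    x (m + m + (2 + t)) ≢ x (suc (m + m + (2 + t)))
  alternatesAfterSquare m t square len with nextSquare t (≤-trans (window-after-blocks m t) len) square
  alternatesAfterSquare zero t _ _ | unequal , _ = unequal
  alternatesAfterSquare (suc m) t _ len | _ , inj₁ square =
    unequal-subst (two-blocks-later m t)
      (alternatesAfterSquare m (2 + t) square (subst (λ u → u + 5 ≤ ℓ) (sym (two-blocks-later m t)) len))
  alternatesAfterSquare (suc zero) t _ _ | _ , inj₂ (unequal , _) = unequal
  alternatesAfterSquare (suc (suc m)) t _ len | _ , inj₂ (_ , square) =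
    unequal-subst four-blocks-later
      (alternatesAfterSquare m (4 + t) square (subst (λ u → u + 5 ≤ ℓ) (sym four-blocks-later) len))
    where
    four-blocks-later : m + m + (2 + (4 + t)) ≡ suc (suc m) + suc (suc m) + (2 + t)
    four-blocks-later = trans (two-blocks-later m (2 + t)) (two-blocks-later (suc m) t)

  thueMorseImage : 6 ≤ ℓ → ∃ λ k → k ≤ 5 × ThueMorseImageFrom x ℓ k
  thueMorseImage len with initialSquare len
  ... | t , t≤3 , square = 2 + t , s≤s (s≤s t≤3) ,
    λ m len′ → ¬-not (alternatesAfterSquare m t square len′ ∘ sym)

bit : Bool → ℕ
bit false = 0
bit true  = 1

bit≤1 : ∀ c → bit c ≤ 1
bit≤1 false = z≤n
bit≤1 true  = ≤-refl

xor-transfer : ∀ e c s {u v} → e xor u ≡ s xor (c xor v) → u ≡ ((e xor c) xor s) xor v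
xor-transfer e c s {u} {v} eq = begin
  u                        ≡⟨ cong (_xor u) (xor-same e) ⟨
  (e xor e) xor u          ≡⟨ xor-assoc e e u ⟩
  e xor (e xor u)          ≡⟨ cong (e xor_) eq ⟩
  e xor (s xor (c xor v))  ≡⟨ cong (e xor_) (xor-assoc s c v) ⟨
  e xor ((s xor c) xor v)  ≡⟨ xor-assoc e (s xor c) v ⟨
  (e xor (s xor c)) xor v  ≡⟨ cong (λ w → (e xor w) xor v) (xor-comm s c) ⟩
  (e xor (c xor s)) xor v  ≡⟨ cong (_xor v) (xor-assoc e c s) ⟨
  ((e xor c) xor s) xor v  ∎
  where open ≡-Reasoning

half-< : ∀ {m n} → m + m < n + n → m < n
half-< lt = ≰⇒> λ n≤m → <⇒≱ lt (+-mono-≤ n≤m n≤m)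

even≤odd⇒≤ : ∀ {α β} → α + α ≤ suc (β + β) → α ≤ β
even≤odd⇒≤ {β = β} le = s≤s⁻¹ (half-< (≤-trans (s≤s le) (≤-reflexive (cong suc (sym (+-suc β β))))))

data EvenOrOdd : ℕ → Set where
  even : ∀ m → EvenOrOdd (m + m)
  odd  : ∀ m → EvenOrOdd (suc (m + m))

evenOrOdd : ∀ n → EvenOrOdd n
evenOrOdd zero = even 0
evenOrOdd (suc zero) = odd 0
evenOrOdd (suc (suc n)) with evenOrOdd n
... | even m = subst (EvenOrOdd ∘ suc) (+-suc m m) (even (suc m))
... | odd m = subst (EvenOrOdd ∘ suc ∘ suc) (+-suc m m) (odd (suc m))

halve : ∀ j → ∃₂ λ m e → m + m + bit e ≡ j
halve j with evenOrOdd j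
... | even m = m , false , +-identityʳ (m + m)
... | odd m = m , true , +-comm (m + m) 1

-- Reading x at the positions 2 j + e + k, a shift by a lands on 2 (j + quotient) + carry + k,
-- so by Desubstitution.block the complementation changes by e ⊕ carry.
record Half (e : Bool) (a : ℕ) : Set where
  constructor half
  field
    quotient : ℕ
    carry    : Bool
    equation : bit e + a ≡ quotient + quotient + bit carry

  sign : Bool → Bool
  sign s = (e xor carry) xor s

open Half

halfEven₀ : ∀ α → Half false (α + α)
halfEven₀ α = half α false (sym (+-identityʳ (α + α)))

halfOdd₀ : ∀ α → Half false (suc (α + α))
halfOdd₀ α = half α true (+-comm 1 (α + α))

halfEven₁ : ∀ α → Half true (α + α)
halfEven₁ α = half α true (+-comm 1 (α + α))

halfOdd₁ : ∀ α → Half true (suc (α + α))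
halfOdd₁ α = half (suc α) false (carried α)
  where
  carried : ∀ α → 1 + suc (α + α) ≡ suc α + suc α + 0
  carried = solve-∀

double-< : ∀ {m n} c d → m < n → m + m + bit d < n + n + bit c
double-< {m} {n} c d m<n = begin-strict
  m + m + bit d  ≤⟨ +-monoʳ-≤ (m + m) (bit≤1 d) ⟩
  m + m + 1      <⟨ +-monoʳ-< (m + m) (n<1+n 1) ⟩
  m + m + 2      ≡⟨ regroup m ⟩
  suc m + suc m  ≤⟨ +-mono-≤ m<n m<n ⟩
  n + n          ≤⟨ m≤m+n (n + n) (bit c) ⟩
  n + n + bit c  ∎
  where
  open ≤-Reasoning
  regroup : ∀ m → m + m + 2 ≡ suc m + suc m
  regroup = solve-∀

quotient-mono : ∀ {e a b} (ha : Half e a) (hb : Half e b) → a ≤ b → quotient ha ≤ quotient hb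
quotient-mono {e} ha hb a≤b = ≮⇒≥ λ b′<a′ →
  <⇒≱ (+-cancelˡ-< (bit e) _ _
        (subst₂ _<_ (sym (equation hb)) (sym (equation ha)) (double-< (carry ha) (carry hb) b′<a′)))
      a≤b

quotient-< : ∀ {e b} (hb : Half e b) → 2 ≤ b → quotient hb < b
quotient-< {e} {b} hb 2≤b = half-< (begin-strict
  quotient hb + quotient hb                   ≤⟨ m≤m+n _ (bit (carry hb)) ⟩
  quotient hb + quotient hb + bit (carry hb)  ≡⟨ equation hb ⟨
  bit e + b                                   ≤⟨ +-monoˡ-≤ b (bit≤1 e) ⟩
  1 + b                                       <⟨ +-monoˡ-< b 2≤b ⟩
  b + b                                       ∎)
  where open ≤-Reasoning

SignedPseudoperiod : Word → ℕ → ℕ → Bool → ℕ → Bool → Set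
SignedPseudoperiod x ℓ a s b t =
  ∀ i → i + b < ℓ → x i ≡ s xor x (i + a) ⊎ x i ≡ t xor x (i + b)

module Desubstitution {x : Word} {ℓ k : ℕ} (k≤5 : k ≤ 5) (image : ThueMorseImageFrom x ℓ k)
                      (ℓ′ : ℕ) (long : ℓ′ + ℓ′ + 12 ≤ ℓ) where

  y : Word
  y m = x (m + m + k)

  inRange : ∀ u → u < ℓ′ → u + u + k + 6 ≤ ℓ
  inRange u u<ℓ′ = begin
    u + u + k + 6      ≤⟨ +-monoˡ-≤ 6 (+-monoʳ-≤ (u + u) k≤5) ⟩
    u + u + 5 + 6      ≡⟨ regroup u ⟩
    suc u + suc u + 9  ≤⟨ +-monoˡ-≤ 9 (+-mono-≤ u<ℓ′ u<ℓ′) ⟩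
    ℓ′ + ℓ′ + 9        ≤⟨ +-monoʳ-≤ (ℓ′ + ℓ′) (m≤m+n 9 3) ⟩
    ℓ′ + ℓ′ + 12       ≤⟨ long ⟩
    ℓ                  ∎
    where
    open ≤-Reasoning
    regroup : ∀ u → u + u + 5 + 6 ≡ suc u + suc u + 9
    regroup = solve-∀

  block : ∀ u e → u < ℓ′ → x (u + u + bit e + k) ≡ e xor y u
  block u false _ = cong (λ v → x (v + k)) (+-identityʳ (u + u))
  block u true u<ℓ′ =
    trans (cong x (regroup u k)) (image u (≤-trans (+-monoʳ-≤ (u + u + k) (n≤1+n 5)) (inRange u u<ℓ′)))
    where
    regroup : ∀ u k → u + u + 1 + k ≡ suc (u + u + k)
    regroup = solve-∀

  powerFree : PowerFree x ℓ → PowerFree y ℓ′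
  powerFree free (i , n , p , i+n≤ℓ′ , 1≤p , per , exp) =
    free (i + i + k , n + n , p + p , fits , ≤-trans 1≤p (m≤m+n p p) , doubled , exp₂)
    where
    fits : i + i + k + (n + n) ≤ ℓ
    fits = begin
      i + i + k + (n + n)    ≡⟨ regroup i k n ⟩
      (i + n) + (i + n) + k  ≤⟨ +-mono-≤ (+-mono-≤ i+n≤ℓ′ i+n≤ℓ′) k≤5 ⟩
      ℓ′ + ℓ′ + 5            ≤⟨ +-monoʳ-≤ (ℓ′ + ℓ′) (m≤m+n 5 7) ⟩
      ℓ′ + ℓ′ + 12           ≤⟨ long ⟩
      ℓ                      ∎
      where
      open ≤-Reasoning
      regroup : ∀ i k n → i + i + k + (n + n) ≡ (i + n) + (i + n) + k
      regroup = solve-∀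

    exp₂ : 7 * (p + p) ≤ 3 * (n + n)
    exp₂ = subst₂ _≤_ (sym (*-distribˡ-+ 7 p p)) (sym (*-distribˡ-+ 3 n n)) (+-mono-≤ exp exp)

    doubled : IsPeriodOfFactor x (i + i + k) (n + n) (p + p)
    doubled j j+2p<2n with halve j
    ... | m , e , refl = begin
      x (i + i + k + (m + m + bit e))            ≡⟨ cong x (regroup₁ i k m (bit e)) ⟩
      x ((i + m) + (i + m) + bit e + k)          ≡⟨ block (i + m) e i+m<ℓ′ ⟩
      e xor y (i + m)                            ≡⟨ cong (e xor_) (per m m+p<n) ⟩
      e xor y (i + m + p)                        ≡⟨ block (i + m + p) e i+m+p<ℓ′ ⟨
      x ((i + m + p) + (i + m + p) + bit e + k)  ≡⟨ cong x (regroup₂ i k m p (bit e)) ⟩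
      x (i + i + k + (m + m + bit e) + (p + p))  ∎
      where
      open ≡-Reasoning
      regroup₁ : ∀ i k m c → i + i + k + (m + m + c) ≡ (i + m) + (i + m) + c + k
      regroup₁ = solve-∀
      regroup₂ : ∀ i k m p c → (i + m + p) + (i + m + p) + c + k ≡ i + i + k + (m + m + c) + (p + p)
      regroup₂ = solve-∀
      regroup₃ : ∀ m p c → (m + p) + (m + p) + c ≡ m + m + c + (p + p)
      regroup₃ = solve-∀
      m+p<n : m + p < n
      m+p<n = half-< (≤-<-trans (≤-trans (m≤m+n _ (bit e)) (≤-reflexive (regroup₃ m p (bit e)))) j+2p<2n)
      i+m+p<ℓ′ : i + m + p < ℓ′
      i+m+p<ℓ′ = ≤-trans (≤-reflexive (cong suc (+-assoc i m p))) (≤-trans (+-monoʳ-< i m+p<n) i+n≤ℓ′)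
      i+m<ℓ′ : i + m < ℓ′
      i+m<ℓ′ = ≤-<-trans (m≤m+n (i + m) p) i+m+p<ℓ′

  shifted : ∀ {e a} (h : Half e a) j →
    j + j + bit e + k + a ≡ (j + quotient h) + (j + quotient h) + bit (carry h) + k
  shifted {e} {a} h j = begin
    j + j + bit e + k + a                              ≡⟨ regroup₁ j (bit e) k a ⟩
    j + j + k + (bit e + a)                            ≡⟨ cong (j + j + k +_) (equation h) ⟩
    j + j + k + (quotient h + quotient h + bit (carry h))  ≡⟨ regroup₂ j k (quotient h) (bit (carry h)) ⟩
    (j + quotient h) + (j + quotient h) + bit (carry h) + k  ∎
    where
    open ≡-Reasoning
    regroup₁ : ∀ j c k a → j + j + c + k + a ≡ j + j + k + (c + a)
    regroup₁ = solve-∀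
    regroup₂ : ∀ j k q c → j + j + k + (q + q + c) ≡ (j + q) + (j + q) + c + k
    regroup₂ = solve-∀

  transfer : ∀ {e a s} (h : Half e a) j → j + quotient h < ℓ′ →
    x (j + j + bit e + k) ≡ s xor x (j + j + bit e + k + a) → y j ≡ sign h s xor y (j + quotient h)
  transfer {e} {a} {s} h j j+q<ℓ′ step = xor-transfer e (carry h) s (begin
    e xor y j                                 ≡⟨ block j e (≤-<-trans (m≤m+n j _) j+q<ℓ′) ⟨
    x (j + j + bit e + k)                     ≡⟨ step ⟩
    s xor x (j + j + bit e + k + a)           ≡⟨ cong (λ u → s xor x u) (shifted h j) ⟩
    s xor x ((j + quotient h) + (j + quotient h) + bit (carry h) + k)
                                              ≡⟨ cong (s xor_) (block (j + quotient h) (carry h) j+q<ℓ′) ⟩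
    s xor (carry h xor y (j + quotient h))    ∎)
    where open ≡-Reasoning

  shiftedInRange : ∀ {e b} (h : Half e b) j → j + quotient h < ℓ′ → j + j + bit e + k + b < ℓ
  shiftedInRange {e} {b} h j j+q<ℓ′ = begin-strict
    j + j + bit e + k + b      ≡⟨ shifted h j ⟩
    u + u + bit (carry h) + k  ≤⟨ +-monoˡ-≤ k (+-monoʳ-≤ (u + u) (bit≤1 (carry h))) ⟩
    u + u + 1 + k              ≡⟨ regroup u k ⟩
    u + u + k + 1              <⟨ +-monoʳ-< (u + u + k) (m≤m+n 2 4) ⟩
    u + u + k + 6              ≤⟨ inRange u j+q<ℓ′ ⟩
    ℓ                          ∎
    where
    open ≤-Reasoning
    u : ℕ
    u = j + quotient h
    regroup : ∀ u k → u + u + 1 + k ≡ u + u + k + 1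
    regroup = solve-∀

  pseudoperiod : ∀ {e a s b t} (ha : Half e a) (hb : Half e b) → quotient ha ≤ quotient hb →
    SignedPseudoperiod x ℓ a s b t →
    SignedPseudoperiod y ℓ′ (quotient ha) (sign ha s) (quotient hb) (sign hb t)
  pseudoperiod {e} ha hb a′≤b′ gp j j+b′<ℓ′ with gp (j + j + bit e + k) (shiftedInRange hb j j+b′<ℓ′)
  ... | inj₁ step = inj₁ (transfer ha j (≤-<-trans (+-monoʳ-≤ j a′≤b′) j+b′<ℓ′) step)
  ... | inj₂ step = inj₂ (transfer hb j j+b′<ℓ′ step)

-- a = 0 with s = false, and a = b with s ≠ t, hold in every word; the case b = 2a with
-- s = t = true is satisfied by the Thue–Morse word (take a = 1), which has no (7/3)-power
record Nondegenerate (a : ℕ) (s : Bool) (b : ℕ) (t : Bool) : Set where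
  constructor nondegenerate
  field
    zero-complemented : a ≡ 0 → s ≡ true
    equal-agree       : a ≡ b → s ≡ t
    not-doubled       : ¬ (s ≡ true × t ≡ true × b ≡ a + a)

open Nondegenerate

Descent : ℕ → Bool → ℕ → Bool → Set
Descent a s b t = ∃ λ e → Σ (Half e a) λ ha → Σ (Half e b) λ hb →
  Nondegenerate (quotient ha) (sign ha s) (quotient hb) (sign hb t)

double : ℕ → ℕ
double n = n + n

descentEvenEven : ∀ {α β s t} → α ≢ 0 → α ≢ β → Nondegenerate (α + α) s (β + β) t →
  Descent (α + α) s (β + β) t
descentEvenEven {α} {β} α≢0 α≢β nd = false , halfEven₀ α , halfEven₀ β ,
  nondegenerate (⊥-elim ∘ α≢0) (⊥-elim ∘ α≢β)
    λ (s≡1 , t≡1 , β≡2α) → not-doubled nd (s≡1 , t≡1 , cong double β≡2α)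

descentOddEven : ∀ {α β s t} → α < β → Nondegenerate (suc (α + α)) s (β + β) t →
  Descent (suc (α + α)) s (β + β) t
descentOddEven {zero} {β} {false} 0<β _ = false , halfOdd₀ 0 , halfEven₀ β ,
  nondegenerate (λ _ → refl) (⊥-elim ∘ <⇒≢ 0<β) (λ (_ , _ , β≡0) → <⇒≢ 0<β (sym β≡0))
descentOddEven {zero} {β} {true} {t} _ nd = true , halfOdd₁ 0 , halfEven₁ β ,
  nondegenerate (λ ()) (λ 1≡β → sym (¬-not λ t≡1 → not-doubled nd (refl , t≡1 , cong double (sym 1≡β))))
    (λ ())
descentOddEven {suc α} {β} {s} {t} α<β nd
  with (not s ≟ᴮ true) ×-dec (t ≟ᴮ true) ×-dec (β ≟ suc α + suc α)
... | yes (s̄≡1 , t≡1 , β≡2α) = true , halfOdd₁ (suc α) , halfEven₁ β ,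
  nondegenerate (λ ()) (λ _ → trans s̄≡1 (sym t≡1))
    λ (_ , _ , β≡2α′) → <⇒≢ (+-mono-< (n<1+n (suc α)) (n<1+n (suc α))) (trans (sym β≡2α) β≡2α′)
... | no undoubled = false , halfOdd₀ (suc α) , halfEven₀ β ,
  nondegenerate (λ ()) (⊥-elim ∘ <⇒≢ α<β) undoubled

descentEvenOdd : ∀ {α β s t} → α ≢ 0 → α ≤ β → Nondegenerate (α + α) s (suc (β + β)) t →
  Descent (α + α) s (suc (β + β)) t
descentEvenOdd {α} {β} {s} {t} α≢0 α≤β nd
  with (s ≟ᴮ true) ×-dec (not t ≟ᴮ true) ×-dec (suc β ≟ α + α)
... | yes (s≡1 , t̄≡1 , 1+β≡2α) = false , halfEven₀ α , halfOdd₀ β ,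
  nondegenerate (⊥-elim ∘ α≢0) (λ _ → trans s≡1 (sym t̄≡1))
    λ (_ , _ , β≡2α) → <⇒≢ (n<1+n β) (trans β≡2α (sym 1+β≡2α))
... | no undoubled = true , halfEven₁ α , halfOdd₁ β ,
  nondegenerate (⊥-elim ∘ α≢0) (λ α≡1+β → ⊥-elim (<⇒≱ (s≤s α≤β) (≤-reflexive (sym α≡1+β)))) undoubled

descentOddOdd : ∀ {α β s t} → α < β → Nondegenerate (suc (α + α)) s (suc (β + β)) t →
  Descent (suc (α + α)) s (suc (β + β)) t
descentOddOdd {α} {β} {s} {t} α<β nd
  with (not s ≟ᴮ true) ×-dec (not t ≟ᴮ true) ×-dec (suc β ≟ suc α + suc α)
... | yes (s̄≡1 , t̄≡1 , 1+β≡2+2α) = false , halfOdd₀ α , halfOdd₀ β ,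
  nondegenerate (λ _ → s̄≡1) (⊥-elim ∘ <⇒≢ α<β)
    λ (_ , _ , β≡2α) → <⇒≢ (n<1+n (α + α))
      (trans (sym β≡2α) (suc-injective (trans 1+β≡2+2α (cong suc (+-suc α α)))))
... | no undoubled = true , halfOdd₁ α , halfOdd₁ β ,
  nondegenerate (λ ()) (⊥-elim ∘ <⇒≢ α<β ∘ suc-injective) undoubled

-- Both offsets give the same signs (s is complemented iff a is odd); the offset is chosen so as
-- to avoid the degenerate cases.
descent : ∀ {a s b t} → a ≤ b → a ≢ 0 → a ≢ b → Nondegenerate a s b t → Descent a s b t
descent {a} {b = b} a≤b a≢0 a≢b nd with evenOrOdd a | evenOrOdd b
... | even α | even β = descentEvenEven {α} {β} (a≢0 ∘ cong double) (a≢b ∘ cong double) nd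
... | odd α  | even β = descentOddEven {α} {β} (half-< a≤b) nd
... | even α | odd β  = descentEvenOdd {α} {β} (a≢0 ∘ cong double) (even≤odd⇒≤ a≤b) nd
... | odd α  | odd β  = descentOddOdd {α} {β} (half-< (≤∧≢⇒< (s≤s⁻¹ a≤b) (a≢b ∘ cong suc))) nd

noSignedPeriod : ∀ {x ℓ q} s → PowerFree x ℓ → 1 ≤ q → 6 * q ≤ ℓ →
  ¬ (∀ i → i + q < ℓ → x i ≡ s xor x (i + q))
noSignedPeriod {x} {ℓ} {q} false free 1≤q 6q≤ℓ period =
  free (0 , 3 * q , q , 3q≤ℓ , 1≤q , (λ j j+q<3q → period j (≤-trans j+q<3q 3q≤ℓ)) , cube)
  where
  3q≤ℓ : 3 * q ≤ ℓ
  3q≤ℓ = ≤-trans (*-monoˡ-≤ q (m≤m+n 3 3)) 6q≤ℓ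
  cube : 7 * q ≤ 3 * (3 * q)
  cube = subst (7 * q ≤_) (*-assoc 3 3 q) (*-monoˡ-≤ q (m≤m+n 7 2))
noSignedPeriod {x} {ℓ} {q} true free 1≤q 6q≤ℓ antiperiod =
  free (0 , 6 * q , q + q , 6q≤ℓ , ≤-trans 1≤q (m≤m+n q q) , period , cube)
  where
  period : IsPeriodOfFactor x 0 (6 * q) (q + q)
  period j j+2q<6q = begin
    x j                  ≡⟨ antiperiod j (≤-<-trans (m≤m+n (j + q) q) j+q+q<ℓ) ⟩
    not (x (j + q))      ≡⟨ cong not (antiperiod (j + q) j+q+q<ℓ) ⟩
    not (not (x (j + q + q))) ≡⟨ not-involutive _ ⟩
    x (j + q + q)        ≡⟨ cong x (+-assoc j q q) ⟩
    x (j + (q + q))      ∎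
    where
    open ≡-Reasoning
    j+q+q<ℓ : j + q + q < ℓ
    j+q+q<ℓ = ≤-trans (≤-reflexive (cong suc (+-assoc j q q))) (≤-trans j+2q<6q 6q≤ℓ)
  cube : 7 * (q + q) ≤ 3 * (6 * q)
  cube = subst₂ _≤_ (fourteen q) (eighteen q) (*-monoˡ-≤ q (m≤m+n 14 4))
    where
    fourteen : ∀ q → 14 * q ≡ 7 * (q + q)
    fourteen = solve-∀
    eighteen : ∀ q → 18 * q ≡ 3 * (6 * q)
    eighteen = solve-∀

complementedZero⇒signedPeriod : ∀ {x ℓ b t} → SignedPseudoperiod x ℓ 0 true b t →
  ∀ i → i + b < ℓ → x i ≡ t xor x (i + b)
complementedZero⇒signedPeriod {x} gp i i+b<ℓ with gp i i+b<ℓ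
... | inj₁ selfComplement = ⊥-elim (not-¬ (cong x (sym (+-identityʳ i))) selfComplement)
... | inj₂ step = step

noZeroPseudoperiod : ∀ {x ℓ s b t} → PowerFree x ℓ → 1 ≤ ℓ → 6 * b ≤ ℓ →
  SignedPseudoperiod x ℓ 0 s b t → Nondegenerate 0 s b t → ⊥
noZeroPseudoperiod {s = false} _ _ _ _ nd with zero-complemented nd refl
... | ()
noZeroPseudoperiod {x} {s = true} {zero} {t} free 1≤ℓ _ gp nd = not-¬ refl
  (subst (λ c → x 0 ≡ c xor x 0) (sym (equal-agree nd refl))
    (complementedZero⇒signedPeriod {t = t} gp 0 1≤ℓ))
noZeroPseudoperiod {s = true} {suc _} {t} free _ 6b≤ℓ gp _ =
  noSignedPeriod t free (s≤s z≤n) 6b≤ℓ (complementedZero⇒signedPeriod {t = t} gp)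

noEqualPseudoperiod : ∀ {x ℓ a s t} → PowerFree x ℓ → 1 ≤ a → 6 * a ≤ ℓ →
  SignedPseudoperiod x ℓ a s a t → s ≡ t → ⊥
noEqualPseudoperiod {x} {ℓ} {a} {s} free 1≤a 6a≤ℓ gp refl = noSignedPeriod s free 1≤a 6a≤ℓ period
  where
  period : ∀ i → i + a < ℓ → x i ≡ s xor x (i + a)
  period i i+a<ℓ with gp i i+a<ℓ
  ... | inj₁ step = step
  ... | inj₂ step = step

requiredLength : ℕ → ℕ
requiredLength zero = 1
requiredLength (suc N) = requiredLength N + requiredLength N + 6 * suc N + 12

requiredLength-positive : ∀ N → 1 ≤ requiredLength N
requiredLength-positive zero = ≤-refl
requiredLength-positive (suc N) = ≤-trans (m≤m+n 1 11) (m≤n+m 12 _)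

6≤requiredLength-suc : ∀ N → 6 ≤ requiredLength (suc N)
6≤requiredLength-suc N = ≤-trans (m≤m+n 6 6) (m≤n+m 12 _)

requiredLength-period : ∀ {N ℓ q} → q ≤ N → requiredLength N ≤ ℓ → 6 * q ≤ ℓ
requiredLength-period {N} q≤N len = ≤-trans (*-monoʳ-≤ 6 q≤N) (≤-trans (bound N) len)
  where
  bound : ∀ N → 6 * N ≤ requiredLength N
  bound zero = z≤n
  bound (suc N) = ≤-trans (m≤n+m (6 * suc N) (requiredLength N + requiredLength N)) (m≤m+n _ 12)

requiredLength-halves : ∀ N → requiredLength N + requiredLength N + 12 ≤ requiredLength (suc N)
requiredLength-halves N = +-monoˡ-≤ 12 (m≤m+n _ (6 * suc N))

NoPseudoperiodUpTo : ℕ → Set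
NoPseudoperiodUpTo N = ∀ {x ℓ a s b t} → b ≤ N → requiredLength N ≤ ℓ → PowerFree x ℓ →
  SignedPseudoperiod x ℓ a s b t → a ≤ b → Nondegenerate a s b t → ⊥

descendThrough : ∀ {x ℓ k N a s b t e} → k ≤ 5 → ThueMorseImageFrom x ℓ k →
  requiredLength N + requiredLength N + 12 ≤ ℓ → NoPseudoperiodUpTo N → PowerFree x ℓ →
  SignedPseudoperiod x ℓ a s b t → a ≤ b → (ha : Half e a) (hb : Half e b) → quotient hb ≤ N →
  Nondegenerate (quotient ha) (sign ha s) (quotient hb) (sign hb t) → ⊥
descendThrough {x} {N = N} k≤5 image long below free gp a≤b ha hb b′≤N nd′ =
  below b′≤N ≤-refl (powerFree free) (pseudoperiod ha hb a′≤b′ gp) a′≤b′ nd′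
  where
  open Desubstitution {x} k≤5 image (requiredLength N) long
  a′≤b′ : quotient ha ≤ quotient hb
  a′≤b′ = quotient-mono ha hb a≤b

descentStep : ∀ N → NoPseudoperiodUpTo N →
  ∀ {x ℓ a s b t} → b ≤ suc N → requiredLength (suc N) ≤ ℓ → PowerFree x ℓ →
  SignedPseudoperiod x ℓ a s b t → a ≤ b → a ≢ 0 → a ≢ b → Nondegenerate a s b t → ⊥
descentStep N below {x} {b = b} b≤1+N len free gp a≤b a≢0 a≢b nd =
  let k , k≤5 , image = thueMorseImage {x} free (≤-trans (6≤requiredLength-suc N) len)
      _ , ha , hb , nd′ = descent a≤b a≢0 a≢b nd
  in descendThrough k≤5 image (≤-trans (requiredLength-halves N) len) below free gp a≤b ha hb
       (s≤s⁻¹ (≤-trans (quotient-< hb 2≤b) b≤1+N)) nd′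
  where
  2≤b : 2 ≤ b
  2≤b = ≤-trans (s≤s (n≢0⇒n>0 a≢0)) (≤∧≢⇒< a≤b a≢b)

noPseudoperiod : ∀ N → NoPseudoperiodUpTo N
noPseudoperiod N {a = a} {b = b} b≤N len free gp a≤b nd with a ≟ 0 | a ≟ b
noPseudoperiod N b≤N len free gp _ nd | yes refl | _ =
  noZeroPseudoperiod free (≤-trans (requiredLength-positive N) len) (requiredLength-period b≤N len) gp nd
noPseudoperiod N b≤N len free gp _ nd | no a≢0 | yes refl =
  noEqualPseudoperiod free (n≢0⇒n>0 a≢0) (requiredLength-period b≤N len) gp (equal-agree nd refl)
noPseudoperiod zero b≤0 _ _ _ a≤b _ | no a≢0 | no _ = a≢0 (n≤0⇒n≡0 (≤-trans a≤b b≤0))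
noPseudoperiod (suc N) b≤1+N len free gp a≤b nd | no a≢0 | no a≢b =
  descentStep N (noPseudoperiod N) b≤1+N len free gp a≤b a≢0 a≢b nd

theorem30 : (x : Word) → TwoPseudoperiodic x → Contains7/3Power x
theorem30 x (p₁ , p₂ , 0<p₁ , p₁<p₂ , pseudoperiodic) with powerBefore? x (requiredLength p₂)
... | yes power = power⇒contains7/3Power {x} power
... | no free = ⊥-elim (noPseudoperiod p₂ {x} {s = false} {t = false} ≤-refl ≤-refl free
  (λ i _ → pseudoperiodic i) (<⇒≤ p₁<p₂) (nondegenerate (⊥-elim ∘ <⇒≢ 0<p₁ ∘ sym) (λ _ → refl) λ ()))
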